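{- Let $m\geq 1$ and let $\overrightarrow{C}_{2m+1}(J)$ be the circulant tournament of order $2m+1$ with $J=\{1,2,\dots,m\}$. Then $dib(\overrightarrow{C}_{2m+1}(J))=m+1$.
   Context: For $n\geq 3$ and a nonempty $J\subseteq\mathbb{Z}_n\setminus\{0\}$ with $|\{ -j,j\}\cap J|=1$ for every $j\in J$, the circulant digraph $\overrightarrow{C}_n(J)$ has vertex set $\mathbb{Z}_n$ and darts $(i,j)$ for all $i,j\in\mathbb{Z}_n$ with $j-i\in J$. A coloring of a digraph with $k$ colors is a surjective map $\varsigma:V\to\{1,\dots,k\}$; it is acyclic if each color class induces a subdigraph with no directed cycle. With respect to $\varsigma$, a vertex $u$ is a $b^+$-vertex if for every color $j\neq\varsigma(u)$ there is a dart $uw$ with $\varsigma(w)=j$, and a $b^-$-vertex if for every color $j\neq \varsigma(u)$ there is a dart $wu$ with $\varsigma(w)=j$. A $b$-coloring is a coloring in which every color class contains a $b^+$-vertex and a $b^-$-vertex. The dib-chromatic number $dib(D)$ is the largest $k$ such that $D$ admits an acyclic $b$-coloring with $k$ colors. -}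

module Defs where

open import Level using (0ℓ)
open import Data.Nat using (ℕ; zero; suc; _+_; _*_; _∸_; _≤_; NonZero)
open import Data.Nat.DivMod using (_%_)
open import Data.Fin using (Fin; toℕ; inject₁; fromℕ) renaming (zero to fzero; suc to fsuc)
open import Data.Product using (Σ; ∃; _×_)
open import Relation.Binary.PropositionalEquality using (_≡_)
open import Relation.Nullary using (¬_)
open import Function.Definitions using (Injective; Surjective)

Digraph : ℕ → Set₁
Digraph n = Fin n → Fin n → Set

-- Circulant digraph C_n(J): vertex set Z_n (= Fin n), dart (i , j) iff j - i (mod n) ∈ J.
-- J is given as a predicate on residues 0 ≤ r < n.
circulant : (n : ℕ) → .{{_ : NonZero n}} → (ℕ → Set) → Digraph n
circulant n J i j = J ((toℕ j + (n ∸ toℕ i)) % n)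

interval1 : ℕ → ℕ → Set
interval1 m r = (1 ≤ r) × (r ≤ m)

circulantTournament : (m : ℕ) → Digraph (suc (2 * m))
circulantTournament m = circulant (suc (2 * m)) (interval1 m)

IsColoring : ∀ {n} (k : ℕ) → (Fin n → Fin k) → Set
IsColoring {n} k ς = Surjective _≡_ _≡_ ς

record DirectedCycleIn {n} (D : Digraph n) (P : Fin n → Set) : Set where
  field
    len    : ℕ
    v      : Fin (suc len) → Fin n
    inj    : Injective _≡_ _≡_ v
    inP    : ∀ i → P (v i)
    step   : ∀ (i : Fin len) → D (v (inject₁ i)) (v (fsuc i))
    close  : D (v (fromℕ len)) (v fzero)

IsAcyclic : ∀ {n k} → Digraph n → (Fin n → Fin k) → Set
IsAcyclic {n} {k} D ς = ∀ (c : Fin k) → ¬ DirectedCycleIn D (λ u → ς u ≡ c)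

IsB⁺ : ∀ {n k} → Digraph n → (Fin n → Fin k) → Fin n → Set
IsB⁺ {n} {k} D ς u = ∀ (j : Fin k) → ¬ (j ≡ ς u) → Σ (Fin n) (λ w → D u w × ς w ≡ j)

IsB⁻ : ∀ {n k} → Digraph n → (Fin n → Fin k) → Fin n → Set
IsB⁻ {n} {k} D ς u = ∀ (j : Fin k) → ¬ (j ≡ ς u) → Σ (Fin n) (λ w → D w u × ς w ≡ j)

IsBColoring : ∀ {n} (k : ℕ) → Digraph n → (Fin n → Fin k) → Set
IsBColoring {n} k D ς =
  IsColoring k ς ×
  (∀ (c : Fin k) → Σ (Fin n) (λ u → ς u ≡ c × IsB⁺ D ς u)) ×
  (∀ (c : Fin k) → Σ (Fin n) (λ u → ς u ≡ c × IsB⁻ D ς u))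

HasAcyclicBColoring : ∀ {n} → Digraph n → ℕ → Set
HasAcyclicBColoring {n} D k = Σ (Fin n → Fin k) (λ ς → IsBColoring k D ς × IsAcyclic D ς)

DibEq : ∀ {n} → Digraph n → ℕ → Set
DibEq D d = HasAcyclicBColoring D d × (∀ k → HasAcyclicBColoring D k → k ≤ d)

-- Color the vertex 0 with 0 and, for 1 ≤ t ≤ m, both t and t + m with t. A color class
-- then has at most two vertices, so it spans no directed cycle of a tournament. The vertex
-- c + m dominates c + m + 1, …, 2m, 0, 1, …, c − 1, which carry every color except c, and
-- the vertex c is dominated by the same vertices; for color 0 the vertex 0 serves both
-- purposes, with out-neighbors 1, …, m and in-neighbors m + 1, …, 2m. Conversely, a
-- b⁺-vertex of a k-coloring needs k − 1 out-neighbors of distinct colors, and every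
-- vertex of the tournament has out-degree m, so k ≤ m + 1.

module Submission where

open import Defs
open import Data.Fin using (Fin; toℕ; fromℕ<; punchIn; #_) renaming (zero to fzero; suc to fsuc)
open import Data.Fin.Properties
  using (toℕ-fromℕ<; toℕ-injective; toℕ<n; punchIn-injective; punchInᵢ≢i; injective⇒≤)
open import Data.Nat using (ℕ; zero; suc; pred; _+_; _*_; _∸_; _≤_; _<_; NonZero; s≤s; s≤s⁻¹; z≤n)
open import Data.Nat.DivMod
  using (_%_; %-distribˡ-+; m%n%n≡m%n; [m+n]%n≡m%n; n%n≡0; m<n⇒m%n≡m)
open import Data.Nat.Properties
  using ( +-assoc; +-comm; +-suc; +-identityʳ; m+[n∸m]≡n; m+n∸n≡m; m∸n+n≡m; m≤n+o⇒m∸n≤o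
        ; <⇒≤; <⇒≱; ≰⇒>; ≤-trans; ≤-reflexive; n≤1+n; m≤m+n; m≤n+m
        ; m<n⇒0<n; m<n⇒n≢0; n≢0⇒n>0; +-mono-≤; +-monoˡ-≤; +-monoˡ-<; +-cancelˡ-≤; +-cancelʳ-≤
        ; m≤n⇒∃[o]m+o≡n; <-cmp; _≤?_; module ≤-Reasoning )
open import Data.Nat.Tactic.RingSolver using (solve-∀)
open import Data.Product using (Σ; _×_; _,_; proj₁; proj₂)
open import Data.Sum as Sum using (_⊎_; inj₁; inj₂)
open import Function using (_∘_)
open import Function.Definitions using (Injective)
open import Relation.Binary.Definitions using (Asymmetric; tri<; tri≈; tri>)
open import Relation.Binary.PropositionalEquality
  using (_≡_; _≢_; refl; sym; trans; cong; cong₂; subst; subst₂; module ≡-Reasoning)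
open import Relation.Nullary using (yes; no; contradiction)

[m%d+n]%d≡[m+n]%d : ∀ m n d .{{_ : NonZero d}} → (m % d + n) % d ≡ (m + n) % d
[m%d+n]%d≡[m+n]%d m n d = begin
  (m % d + n) % d           ≡⟨ %-distribˡ-+ (m % d) n d ⟩
  (m % d % d + n % d) % d   ≡⟨ cong (λ x → (x + n % d) % d) (m%n%n≡m%n m d) ⟩
  (m % d + n % d) % d       ≡⟨ %-distribˡ-+ m n d ⟨
  (m + n) % d               ∎
  where open ≡-Reasoning

[m+n%d]%d≡[m+n]%d : ∀ m n d .{{_ : NonZero d}} → (m + n % d) % d ≡ (m + n) % d
[m+n%d]%d≡[m+n]%d m n d = begin
  (m + n % d) % d  ≡⟨ cong (_% d) (+-comm m (n % d)) ⟩
  (n % d + m) % d  ≡⟨ [m%d+n]%d≡[m+n]%d n m d ⟩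
  (n + m) % d      ≡⟨ cong (_% d) (+-comm n m) ⟩
  (m + n) % d      ∎
  where open ≡-Reasoning

-- (b − a) mod n: circulant n J i j is by definition J (offset n (toℕ i) (toℕ j)).
offset : (n : ℕ) .{{_ : NonZero n}} → ℕ → ℕ → ℕ
offset n a b = (b + (n ∸ a)) % n

module _ {n : ℕ} .{{_ : NonZero n}} {a : ℕ} (a≤n : a ≤ n) where
  open ≡-Reasoning

  a+[b+[n∸a]]≡b+n : ∀ b → a + (b + (n ∸ a)) ≡ b + n
  a+[b+[n∸a]]≡b+n b = begin
    a + (b + (n ∸ a))  ≡⟨ cong (a +_) (+-comm b (n ∸ a)) ⟩
    a + ((n ∸ a) + b)  ≡⟨ +-assoc a (n ∸ a) b ⟨
    a + (n ∸ a) + b    ≡⟨ cong (_+ b) (m+[n∸m]≡n a≤n) ⟩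
    n + b              ≡⟨ +-comm n b ⟩
    b + n              ∎

  offset-shift : ∀ {d} → d < n → offset n a ((a + d) % n) ≡ d
  offset-shift {d} d<n = begin
    ((a + d) % n + (n ∸ a)) % n  ≡⟨ [m%d+n]%d≡[m+n]%d (a + d) (n ∸ a) n ⟩
    (a + d + (n ∸ a)) % n        ≡⟨ cong (_% n) (+-assoc a d (n ∸ a)) ⟩
    (a + (d + (n ∸ a))) % n      ≡⟨ cong (_% n) (a+[b+[n∸a]]≡b+n d) ⟩
    (d + n) % n                  ≡⟨ [m+n]%n≡m%n d n ⟩
    d % n                        ≡⟨ m<n⇒m%n≡m d<n ⟩
    d                            ∎

  offset-inverse : ∀ {b} → b < n → (a + offset n a b) % n ≡ b
  offset-inverse {b} b<n = begin
    (a + (b + (n ∸ a)) % n) % n  ≡⟨ [m+n%d]%d≡[m+n]%d a (b + (n ∸ a)) n ⟩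
    (a + (b + (n ∸ a))) % n      ≡⟨ cong (_% n) (a+[b+[n∸a]]≡b+n b) ⟩
    (b + n) % n                  ≡⟨ [m+n]%n≡m%n b n ⟩
    b % n                        ≡⟨ m<n⇒m%n≡m b<n ⟩
    b                            ∎

  offset-injective : ∀ {b c} → b < n → c < n → offset n a b ≡ offset n a c → b ≡ c
  offset-injective {b} {c} b<n c<n eq = begin
    b                        ≡⟨ offset-inverse b<n ⟨
    (a + offset n a b) % n   ≡⟨ cong (λ r → (a + r) % n) eq ⟩
    (a + offset n a c) % n   ≡⟨ offset-inverse c<n ⟩
    c                        ∎

[offset-ab+offset-ba]%n≡0 : ∀ {n} .{{_ : NonZero n}} {a b} → a ≤ n → b ≤ n →
                             (offset n a b + offset n b a) % n ≡ 0
[offset-ab+offset-ba]%n≡0 {n} {a} {b} a≤n b≤n = begin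
  ((b + (n ∸ a)) % n + (a + (n ∸ b)) % n) % n  ≡⟨ %-distribˡ-+ (b + (n ∸ a)) (a + (n ∸ b)) n ⟨
  ((b + (n ∸ a)) + (a + (n ∸ b))) % n          ≡⟨ cong (_% n) (swap b (n ∸ a) a (n ∸ b)) ⟩
  ((a + (n ∸ a)) + (b + (n ∸ b))) % n
    ≡⟨ cong₂ (λ p q → (p + q) % n) (m+[n∸m]≡n a≤n) (m+[n∸m]≡n b≤n) ⟩
  (n + n) % n                                  ≡⟨ [m+n]%n≡m%n n n ⟩
  n % n                                        ≡⟨ n%n≡0 n ⟩
  0                                            ∎
  where
    open ≡-Reasoning
    swap : ∀ b x a y → (b + x) + (a + y) ≡ (a + x) + (b + y)
    swap = solve-∀

pigeonhole-two : ∀ {A : Set} {x y z p q : A} →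
  x ≡ p ⊎ x ≡ q → y ≡ p ⊎ y ≡ q → z ≡ p ⊎ z ≡ q → x ≡ y ⊎ x ≡ z ⊎ y ≡ z
pigeonhole-two (inj₁ refl) (inj₁ refl) _           = inj₁ refl
pigeonhole-two (inj₂ refl) (inj₂ refl) _           = inj₁ refl
pigeonhole-two (inj₁ refl) (inj₂ refl) (inj₁ refl) = inj₂ (inj₁ refl)
pigeonhole-two (inj₁ refl) (inj₂ refl) (inj₂ refl) = inj₂ (inj₂ refl)
pigeonhole-two (inj₂ refl) (inj₁ refl) (inj₁ refl) = inj₂ (inj₂ refl)
pigeonhole-two (inj₂ refl) (inj₁ refl) (inj₂ refl) = inj₂ (inj₁ refl)

AtMostTwoToOne : ∀ {A B : Set} → (A → B) → Set
AtMostTwoToOne f = ∀ {x y z} → f x ≡ f y → f x ≡ f z → x ≡ y ⊎ x ≡ z ⊎ y ≡ z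

module _ {n k : ℕ} {D : Digraph n} {ς : Fin n → Fin k} where

  acyclic-if-atMostTwoToOne : Asymmetric D → AtMostTwoToOne ς → IsAcyclic D ς
  acyclic-if-atMostTwoToOne asym _ _ record { len = zero ; close = loop } = asym loop loop
  acyclic-if-atMostTwoToOne asym _ _ record { len = suc zero ; step = step ; close = back } =
    asym (step fzero) back
  acyclic-if-atMostTwoToOne _ twoToOne _ record { len = suc (suc _) ; inj = inj ; inP = inP }
    with twoToOne (trans (inP (# 0)) (sym (inP (# 1)))) (trans (inP (# 0)) (sym (inP (# 2))))
  ... | inj₁ v₀≡v₁ with () ← inj v₀≡v₁
  ... | inj₂ (inj₁ v₀≡v₂) with () ← inj v₀≡v₂
  ... | inj₂ (inj₂ v₁≡v₂) with () ← inj v₁≡v₂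

module _ {n k : ℕ} {D : Digraph n} {ς : Fin n → Fin (suc k)} {u : Fin n} where

  b⁺-injectiveOutNeighbors : IsB⁺ D ς u →
    Σ (Fin k → Fin n) λ f → Injective _≡_ _≡_ f × (∀ i → D u (f i))
  b⁺-injectiveOutNeighbors b⁺ = f , f-injective , λ i → proj₁ (proj₂ (witness i))
    where
      open ≡-Reasoning
      witness : ∀ i → Σ (Fin n) λ w → D u w × ς w ≡ punchIn (ς u) i
      witness i = b⁺ (punchIn (ς u) i) (punchInᵢ≢i (ς u) i)
      f : Fin k → Fin n
      f = proj₁ ∘ witness
      f-injective : Injective _≡_ _≡_ f
      f-injective {i} {j} fi≡fj = punchIn-injective (ς u) i j (begin
        punchIn (ς u) i  ≡⟨ proj₂ (proj₂ (witness i)) ⟨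
        ς (f i)          ≡⟨ cong ς fi≡fj ⟩
        ς (f j)          ≡⟨ proj₂ (proj₂ (witness j)) ⟩
        punchIn (ς u) j  ∎)

module _ {n : ℕ} .{{_ : NonZero n}} {J : ℕ → Set} where

  circulant-dart : ∀ {u w : Fin n} {d} → J d → d < n → (toℕ u + d) % n ≡ toℕ w →
                   circulant n J u w
  circulant-dart {u} {w} {d} Jd d<n u+d≡w = subst J (sym offset≡d) Jd
    where
      offset≡d : offset n (toℕ u) (toℕ w) ≡ d
      offset≡d = subst (λ x → offset n (toℕ u) x ≡ d) u+d≡w
                   (offset-shift (<⇒≤ (toℕ<n u)) d<n)

  circulant-asymmetric : (∀ {d e} → J d → J e → (d + e) % n ≢ 0) → Asymmetric (circulant n J)
  circulant-asymmetric oriented {u} {w} Juw Jwu =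
    oriented {offset n (toℕ u) (toℕ w)} {offset n (toℕ w) (toℕ u)} Juw Jwu
      ([offset-ab+offset-ba]%n≡0 (<⇒≤ (toℕ<n u)) (<⇒≤ (toℕ<n w)))

  circulant-injectiveOutNeighbors≤ : ∀ {m k u} → (∀ {r} → J r → interval1 m r) →
    (f : Fin k → Fin n) → Injective _≡_ _≡_ f → (∀ i → circulant n J u (f i)) → k ≤ m
  circulant-injectiveOutNeighbors≤ {m} {k} {u} J⊆[1,m] f f-injective dart =
    injective⇒≤ code-injective
    where
      pred<m : ∀ {r} → interval1 m r → pred r < m
      pred<m {suc _} (_ , r≤m) = r≤m
      pred-injective : ∀ {r s} → interval1 m r → interval1 m s → pred r ≡ pred s → r ≡ s
      pred-injective {suc _} {suc _} _ _ = cong suc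
      offsetOf : Fin k → ℕ
      offsetOf i = offset n (toℕ u) (toℕ (f i))
      offsetOf∈[1,m] : ∀ i → interval1 m (offsetOf i)
      offsetOf∈[1,m] i = J⊆[1,m] {offsetOf i} (dart i)
      offsetOf-injective : ∀ {i j} → offsetOf i ≡ offsetOf j → i ≡ j
      offsetOf-injective =
        f-injective ∘ toℕ-injective ∘ offset-injective (<⇒≤ (toℕ<n u)) (toℕ<n _) (toℕ<n _)
      code : Fin k → Fin m
      code i = fromℕ< (pred<m (offsetOf∈[1,m] i))
      code-injective : Injective _≡_ _≡_ code
      code-injective {i} {j} eq = offsetOf-injective
        (pred-injective (offsetOf∈[1,m] i) (offsetOf∈[1,m] j)
          (trans (sym (toℕ-fromℕ< _)) (trans (cong toℕ eq) (toℕ-fromℕ< _))))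

  circulant-bColors≤ : ∀ {m k} {ς : Fin n → Fin k} → (∀ {r} → J r → interval1 m r) →
    IsBColoring k (circulant n J) ς → k ≤ suc m
  circulant-bColors≤ {k = zero} _ _ = z≤n
  circulant-bColors≤ {k = suc k} J⊆[1,m] (_ , b⁺-vertex , _) with b⁺-vertex fzero
  ... | u , _ , b⁺
    with f , f-injective , dart ← b⁺-injectiveOutNeighbors {D = circulant n J} b⁺ =
    s≤s (circulant-injectiveOutNeighbors≤ {u = u} J⊆[1,m] f f-injective dart)

module CirculantTournament (m : ℕ) where

  N : ℕ
  N = suc (2 * m)

  m+m≡2m : m + m ≡ 2 * m
  m+m≡2m = cong (m +_) (sym (+-identityʳ m))

  m≤2m : m ≤ 2 * m
  m≤2m = m≤m+n m (m + 0)

  lo<N : ∀ {t} → t ≤ m → t < N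
  lo<N t≤m = s≤s (≤-trans t≤m m≤2m)

  hi≤2m : ∀ {t} → t ≤ m → t + m ≤ 2 * m
  hi≤2m t≤m = ≤-trans (+-monoˡ-≤ m t≤m) (≤-reflexive m+m≡2m)

  hi<N : ∀ {t} → t ≤ m → t + m < N
  hi<N t≤m = s≤s (hi≤2m t≤m)

  Arc : ℕ → ℕ → Set
  Arc x y = Σ ℕ λ d → interval1 m d × (x + d) % N ≡ y

  arc-forward : ∀ {x y} → x < y → y ≤ x + m → y ≤ 2 * m → Arc x y
  arc-forward {x} x<y y≤x+m y≤2m with k , refl ← m≤n⇒∃[o]m+o≡n x<y =
    suc k , (s≤s z≤n , +-cancelˡ-≤ x (suc k) m (subst (_≤ x + m) (sym (+-suc x k)) y≤x+m)) ,
    trans (cong (_% N) (+-suc x k)) (m<n⇒m%n≡m (s≤s y≤2m))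

  arc-backward : ∀ {x y} → y + m < x → x ≤ 2 * m → Arc x y
  arc-backward {x} {y} y+m<x x≤2m with l , x+l≡2m ← m≤n⇒∃[o]m+o≡n x≤2m =
    suc (y + l) , (s≤s z≤n , +-cancelʳ-≤ m (suc (y + l)) m d+m≤m+m) , x+d%N≡y
    where
      d+m≤m+m : suc (y + l) + m ≤ m + m
      d+m≤m+m = begin
        suc (y + l) + m  ≡⟨ rearrange y l m ⟩
        suc (y + m) + l  ≤⟨ +-monoˡ-≤ l y+m<x ⟩
        x + l            ≡⟨ x+l≡2m ⟩
        2 * m            ≡⟨ m+m≡2m ⟨
        m + m            ∎
        where
          open ≤-Reasoning
          rearrange : ∀ y l m → suc (y + l) + m ≡ suc (y + m) + l
          rearrange = solve-∀
      y<N : y < N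
      y<N = ≤-trans (s≤s (m≤m+n y m)) (≤-trans y+m<x (≤-trans x≤2m (n≤1+n (2 * m))))
      x+d%N≡y : (x + suc (y + l)) % N ≡ y
      x+d%N≡y = begin
        (x + suc (y + l)) % N    ≡⟨ cong (_% N) (rearrange x y l) ⟩
        (y + suc (x + l)) % N    ≡⟨ cong (λ z → (y + suc z) % N) x+l≡2m ⟩
        (y + N) % N              ≡⟨ [m+n]%n≡m%n y N ⟩
        y % N                    ≡⟨ m<n⇒m%n≡m y<N ⟩
        y                        ∎
        where
          open ≡-Reasoning
          rearrange : ∀ x y l → x + suc (y + l) ≡ y + suc (x + l)
          rearrange = solve-∀

  arc⇒dart : ∀ {x y} (x<N : x < N) (y<N : y < N) → Arc x y →
    circulantTournament m (fromℕ< x<N) (fromℕ< y<N)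
  arc⇒dart x<N y<N (d , d∈J , x+d≡y) =
    circulant-dart {J = interval1 m} {u = fromℕ< x<N} {w = fromℕ< y<N} d∈J (lo<N (proj₂ d∈J))
      (subst₂ (λ a b → (a + d) % N ≡ b) (sym (toℕ-fromℕ< x<N)) (sym (toℕ-fromℕ< y<N)) x+d≡y)

  tournament-asymmetric : Asymmetric (circulantTournament m)
  tournament-asymmetric {u} {w} = circulant-asymmetric {J = interval1 m} oriented {u} {w}
    where
      oriented : ∀ {d e} → interval1 m d → interval1 m e → (d + e) % N ≢ 0
      oriented {d} {e} (1≤d , d≤m) (_ , e≤m) d+e%N≡0 =
        m<n⇒n≢0 (≤-trans 1≤d (m≤m+n d e)) (trans (sym (m<n⇒m%n≡m d+e<N)) d+e%N≡0)
        where
          d+e<N : d + e < N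
          d+e<N = s≤s (≤-trans (+-mono-≤ d≤m e≤m) (≤-reflexive m+m≡2m))

  color : ℕ → ℕ
  color x with x ≤? m
  ... | yes _ = x
  ... | no _  = x ∸ m

  color-lo : ∀ {x} → x ≤ m → color x ≡ x
  color-lo {x} x≤m with x ≤? m
  ... | yes _  = refl
  ... | no x≰m = contradiction x≤m x≰m

  color-hi : ∀ {t} → 1 ≤ t → color (t + m) ≡ t
  color-hi {t} 1≤t with t + m ≤? m
  ... | yes t+m≤m = contradiction t+m≤m (<⇒≱ (+-monoˡ-≤ m 1≤t))
  ... | no _      = m+n∸n≡m t m

  color-≤ : ∀ {x} → x ≤ 2 * m → color x ≤ m
  color-≤ {x} x≤2m with x ≤? m
  ... | yes x≤m = x≤m
  ... | no _    = ≤-trans (m≤n+o⇒m∸n≤o x m x≤2m) (≤-reflexive (+-identityʳ m))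

  color-fibre : ∀ {x t} → color x ≡ t → x ≡ t ⊎ x ≡ t + m
  color-fibre {x} color≡t with x ≤? m
  ... | yes _  = inj₁ color≡t
  ... | no x≰m = inj₂ (trans (sym (m∸n+n≡m (<⇒≤ (≰⇒> x≰m)))) (cong (_+ m) color≡t))

  coloring : Fin N → Fin (suc m)
  coloring u = fromℕ< (s≤s (color-≤ (s≤s⁻¹ (toℕ<n u))))

  toℕ-coloring : ∀ u → toℕ (coloring u) ≡ color (toℕ u)
  toℕ-coloring u = toℕ-fromℕ< _

  coloring-fromℕ< : ∀ {x c} (x<N : x < N) → color x ≡ toℕ c → coloring (fromℕ< x<N) ≡ c
  coloring-fromℕ< x<N color≡c =
    toℕ-injective (trans (toℕ-coloring (fromℕ< x<N))
                         (trans (cong color (toℕ-fromℕ< x<N)) color≡c))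

  coloring-atMostTwoToOne : AtMostTwoToOne coloring
  coloring-atMostTwoToOne {u} {v} {w} u~v u~w =
    Sum.map toℕ-injective (Sum.map toℕ-injective toℕ-injective)
      (pigeonhole-two (fibre {u} refl) (fibre u~v) (fibre u~w))
    where
      fibre : ∀ {x} → coloring u ≡ coloring x →
              toℕ x ≡ color (toℕ u) ⊎ toℕ x ≡ color (toℕ u) + m
      fibre {x} u~x = color-fibre
        (trans (sym (toℕ-coloring x)) (trans (cong toℕ (sym u~x)) (toℕ-coloring u)))

  ≢coloring⇒≢color : ∀ {x c} (x<N : x < N) → c ≢ coloring (fromℕ< x<N) → toℕ c ≢ color x
  ≢coloring⇒≢color x<N c≢ = c≢ ∘ sym ∘ coloring-fromℕ< x<N ∘ sym

  OutRainbow InRainbow : ℕ → Set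
  OutRainbow x = ∀ t → t ≤ m → t ≢ color x → Σ ℕ λ y → y < N × color y ≡ t × Arc x y
  InRainbow  x = ∀ t → t ≤ m → t ≢ color x → Σ ℕ λ y → y < N × color y ≡ t × Arc y x

  outRainbow-0 : OutRainbow 0
  outRainbow-0 t t≤m t≢0 =
    t , lo<N t≤m , color-lo t≤m , arc-forward (n≢0⇒n>0 t≢0) t≤m (≤-trans t≤m m≤2m)

  inRainbow-0 : InRainbow 0
  inRainbow-0 t t≤m t≢0 =
    t + m , hi<N t≤m , color-hi (n≢0⇒n>0 t≢0) ,
    arc-backward (+-monoˡ-< m (n≢0⇒n>0 t≢0)) (hi≤2m t≤m)

  outRainbow-hi : ∀ {c} → 1 ≤ c → c ≤ m → OutRainbow (c + m)
  outRainbow-hi {c} 1≤c c≤m t t≤m t≢c with <-cmp t c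
  ... | tri< t<c _ _ = t , lo<N t≤m , color-lo t≤m ,
    arc-backward (+-monoˡ-< m t<c) (hi≤2m c≤m)
  ... | tri≈ _ t≡c _ = contradiction (trans t≡c (sym (color-hi 1≤c))) t≢c
  ... | tri> _ _ c<t = t + m , hi<N t≤m , color-hi (m<n⇒0<n c<t) ,
    arc-forward (+-monoˡ-< m c<t) (+-monoˡ-≤ m (≤-trans t≤m (m≤n+m m c))) (hi≤2m t≤m)

  inRainbow-lo : ∀ {c} → 1 ≤ c → c ≤ m → InRainbow c
  inRainbow-lo {c} 1≤c c≤m t t≤m t≢c with <-cmp t c
  ... | tri< t<c _ _ = t , lo<N t≤m , color-lo t≤m ,
    arc-forward t<c (≤-trans c≤m (m≤n+m m t)) (≤-trans c≤m m≤2m)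
  ... | tri≈ _ t≡c _ = contradiction (trans t≡c (sym (color-lo c≤m))) t≢c
  ... | tri> _ _ c<t = t + m , hi<N t≤m , color-hi (m<n⇒0<n c<t) ,
    arc-backward (+-monoˡ-< m c<t) (hi≤2m t≤m)

  toℕ≤m : (c : Fin (suc m)) → toℕ c ≤ m
  toℕ≤m c = s≤s⁻¹ (toℕ<n c)

  b⁺-of-outRainbow : ∀ {x} (x<N : x < N) → OutRainbow x →
                     IsB⁺ (circulantTournament m) coloring (fromℕ< x<N)
  b⁺-of-outRainbow x<N rainbow j j≢
    with y , y<N , color-y , arc ← rainbow (toℕ j) (toℕ≤m j) (≢coloring⇒≢color x<N j≢) =
    fromℕ< y<N , arc⇒dart x<N y<N arc , coloring-fromℕ< y<N color-y

  b⁻-of-inRainbow : ∀ {x} (x<N : x < N) → InRainbow x →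
                    IsB⁻ (circulantTournament m) coloring (fromℕ< x<N)
  b⁻-of-inRainbow x<N rainbow j j≢
    with y , y<N , color-y , arc ← rainbow (toℕ j) (toℕ≤m j) (≢coloring⇒≢color x<N j≢) =
    fromℕ< y<N , arc⇒dart y<N x<N arc , coloring-fromℕ< y<N color-y

  b⁺-vertex : ∀ c → Σ (Fin N) λ u → coloring u ≡ c × IsB⁺ (circulantTournament m) coloring u
  b⁺-vertex fzero = fromℕ< 0<N , coloring-fromℕ< 0<N (color-lo z≤n) ,
    b⁺-of-outRainbow 0<N outRainbow-0
    where 0<N = lo<N z≤n
  b⁺-vertex (fsuc c) = fromℕ< c+m<N , coloring-fromℕ< c+m<N (color-hi (s≤s z≤n)) ,
    b⁺-of-outRainbow c+m<N (outRainbow-hi (s≤s z≤n) (toℕ≤m (fsuc c)))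
    where c+m<N = hi<N (toℕ≤m (fsuc c))

  b⁻-vertex : ∀ c → Σ (Fin N) λ u → coloring u ≡ c × IsB⁻ (circulantTournament m) coloring u
  b⁻-vertex fzero = fromℕ< 0<N , coloring-fromℕ< 0<N (color-lo z≤n) ,
    b⁻-of-inRainbow 0<N inRainbow-0
    where 0<N = lo<N z≤n
  b⁻-vertex (fsuc c) = fromℕ< c<N , coloring-fromℕ< c<N (color-lo (toℕ≤m (fsuc c))) ,
    b⁻-of-inRainbow c<N (inRainbow-lo (s≤s z≤n) (toℕ≤m (fsuc c)))
    where c<N = lo<N (toℕ≤m (fsuc c))

  coloring-surjective : IsColoring (suc m) coloring
  coloring-surjective c = proj₁ (b⁺-vertex c) , λ { refl → proj₁ (proj₂ (b⁺-vertex c)) }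

  acyclicBColoring : HasAcyclicBColoring (circulantTournament m) (suc m)
  acyclicBColoring = coloring , (coloring-surjective , b⁺-vertex , b⁻-vertex) ,
    acyclic-if-atMostTwoToOne (λ {u} {w} → tournament-asymmetric {u} {w}) coloring-atMostTwoToOne

corollary9 : (m : ℕ) → 1 ≤ m → DibEq (circulantTournament m) (suc m)
corollary9 m _ =
  acyclicBColoring , λ _ (_ , bColoring , _) → circulant-bColors≤ (λ r∈J → r∈J) bColoring
  where open CirculantTournament m
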